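{- Let $s\geq 0$ be a fixed integer and $G(q,s)=\sum_{n\geq 0} ac(n,s)q^n$. Then for $|q|<1$, \[G(q,s)=\frac{2^{\lfloor s/2\rfloor}q^{\lfloor 3s/2\rfloor}}{(1-q)^s(1+q)^{\lfloor s/2\rfloor}}.\]
   Context: A composition of $n$ of length $s$ is a sequence $\sigma=(\sigma_1,\ldots,\sigma_s)$ of positive integers with $\sum_i\sigma_i=n$; the empty composition is the unique composition of $0$, of length $0$. A composition is anti-palindromic if $\sigma_i\neq\sigma_{s-i+1}$ for all $i$ with $i\neq\frac{s+1}{2}$ (the empty composition is vacuously anti-palindromic). $ac(n,s)$ denotes the number of anti-palindromic compositions of $n$ of length $s$. -}

module Defs where

open import Data.Nat using (ℕ; zero; suc; _+_; _*_; _∸_; _≟_)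
open import Data.Fin using (Fin; toℕ; opposite)
open import Data.Fin.Properties using (all?)
open import Data.Vec using (Vec; []; _∷_; lookup)
open import Data.List using (List; []; _∷_; map; concatMap; upTo; filter; length)
open import Data.Integer using (ℤ; +_) renaming (_-_ to _-ℤ_; _+_ to _+ℤ_)
open import Relation.Binary.PropositionalEquality using (_≡_; _≢_)
open import Relation.Nullary using (Dec; ¬?; _→-dec_)
open import Function using (_∘_)

-- All compositions of n of length s, as vectors of positive naturals summing to n.
-- The first part ranges over 1..n (written suc k with k < n).
compositions : ℕ → (s : ℕ) → List (Vec ℕ s)
compositions zero    zero    = [] ∷ []
compositions (suc n) zero    = []
compositions n       (suc s) =
  concatMap (λ k → map (suc k ∷_) (compositions (n ∸ suc k) s)) (upTo n)

-- Anti-palindromic (0-indexed): for every index i of σ other than the middle one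
-- (2i+1 = s), σ_i ≠ σ_{s-1-i}  (opposite i = s-1-i).
AntiPalindromic : {s : ℕ} → Vec ℕ s → Set
AntiPalindromic {s} σ =
  (i : Fin s) → (2 * toℕ i + 1 ≢ s) → lookup σ i ≢ lookup σ (opposite i)

antiPalindromic? : {s : ℕ} → (σ : Vec ℕ s) → Dec (AntiPalindromic σ)
antiPalindromic? {s} σ =
  all? (λ i → ¬? (2 * toℕ i + 1 ≟ s) →-dec ¬? (lookup σ i ≟ lookup σ (opposite i)))

ac : ℕ → ℕ → ℕ
ac n s = length (filter antiPalindromic? (compositions n s))

-- Formal power series with integer coefficients: ℕ → ℤ (coefficient of q^n).
Series : Set
Series = ℕ → ℤ

G : ℕ → Series
G s n = + ac n s

mul1-q : Series → Series
mul1-q f zero    = f zero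
mul1-q f (suc n) = f (suc n) -ℤ f n

mul1+q : Series → Series
mul1+q f zero    = f zero
mul1+q f (suc n) = f (suc n) +ℤ f n

iter : ℕ → (Series → Series) → Series → Series
iter zero    g f = f
iter (suc k) g f = g (iter k g f)

monomial : ℤ → ℕ → Series
monomial c m n with n ≟ m
... | Relation.Nullary.yes _ = c
... | Relation.Nullary.no  _ = + 0

-- An anti-palindromic composition of length s + 2 is a first part x, a last part y ≠ x, and an
-- arbitrary anti-palindromic composition of length s in between. Hence
--   G(q, s+2) = (Σ_{x≠y} q^{x+y}) G(q, s) = (q²/(1-q)² - q²/(1-q²)) G(q, s) = 2q³/((1-q)²(1+q)) G(q, s),
-- and the formula follows by induction on s from G(q,0) = 1 and G(q,1) = q/(1-q).
module Submission where

open import Defs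
open import Data.Bool using (Bool; true; false; not; _∧_; if_then_else_)
open import Data.Fin using (Fin; zero; suc; toℕ; opposite; inject₁; fromℕ)
open import Data.Fin.Properties using (toℕ-inject₁; opposite-involutive)
open import Data.List using (List; []; _∷_; map; concatMap; applyUpTo; filter; length; _++_)
open import Data.List.Properties using (length-++; filter-++)
open import Data.Nat using (ℕ; zero; suc; pred; _+_; _*_; _∸_; _^_; _/_; _≟_; _<_; z<s; s<s; s≤s)
open import Data.Nat.DivMod using (+-distrib-/-∣ˡ)
open import Data.Nat.Divisibility using (divides)
open import Data.Nat.Properties
  using (+-comm; +-assoc; +-identityʳ; *-suc; *-distribˡ-+; suc-injective;
         ∸-+-assoc; m∸[m∸n]≡n; pred[m∸n]≡m∸[1+n]; m≤n⇒m∸n≡0; n≤1+n; +-commutativeSemigroup)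
open import Algebra.Properties.CommutativeSemigroup +-commutativeSemigroup using (interchange)
open import Data.Product using (∃; _×_; _,_)
open import Data.Sum using (_⊎_; inj₁; inj₂)
open import Data.Vec using (Vec; []; _∷_; _∷ʳ_; lookup)
open import Function using (id; _∘_; _⇔_; mk⇔; Equivalence)
open import Level using (Level)
open import Relation.Nullary using (¬?; _×-dec_; does; yes; no; contradiction)
open import Relation.Nullary.Decidable using (does-⇔)
open import Relation.Unary using (Pred; Decidable)
open import Relation.Binary.PropositionalEquality
  using (_≡_; _≢_; _≗_; refl; sym; trans; cong; cong₂; module ≡-Reasoning)

∑ : ℕ → (ℕ → ℕ) → ℕ
∑ zero    f = 0
∑ (suc n) f = f 0 + ∑ n (f ∘ suc)

∑-cong : ∀ n {f g : ℕ → ℕ} → (∀ k → k < n → f k ≡ g k) → ∑ n f ≡ ∑ n g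
∑-cong zero    f≡g = refl
∑-cong (suc n) f≡g = cong₂ _+_ (f≡g 0 z<s) (∑-cong n (λ k k<n → f≡g (suc k) (s<s k<n)))

∑-zeros : ∀ n {f : ℕ → ℕ} → (∀ k → f k ≡ 0) → ∑ n f ≡ 0
∑-zeros zero    f≡0 = refl
∑-zeros (suc n) f≡0 = cong₂ _+_ (f≡0 0) (∑-zeros n (f≡0 ∘ suc))

∑-distrib-+ : ∀ n (f g : ℕ → ℕ) → ∑ n f + ∑ n g ≡ ∑ n (λ k → f k + g k)
∑-distrib-+ zero    f g = refl
∑-distrib-+ (suc n) f g =
  trans (interchange (f 0) (∑ n (f ∘ suc)) (g 0) (∑ n (g ∘ suc)))
        (cong (f 0 + g 0 +_) (∑-distrib-+ n (f ∘ suc) (g ∘ suc)))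

∑-last : ∀ n f → ∑ (suc n) f ≡ ∑ n f + f n
∑-last zero    f = +-comm (f 0) 0
∑-last (suc n) f = trans (cong (f 0 +_) (∑-last n (f ∘ suc))) (sym (+-assoc (f 0) _ _))

∑-reverse : ∀ n f → ∑ n f ≡ ∑ n (λ k → f (n ∸ suc k))
∑-reverse zero    f = refl
∑-reverse (suc n) f =
  trans (∑-last n f) (trans (cong (_+ f n) (∑-reverse n f)) (+-comm _ (f n)))

∑-antidiagonal : ℕ → (ℕ → ℕ → ℕ) → ℕ
∑-antidiagonal n h = ∑ n (λ a → h a (n ∸ suc a))

∑-triangle : ℕ → (ℕ → ℕ → ℕ) → ℕ
∑-triangle n h = ∑ n (λ a → ∑ (n ∸ suc a) (h a))

∑-triangle-suc : ∀ n h → ∑-triangle (suc n) h ≡ ∑-triangle n h + ∑-antidiagonal n h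
∑-triangle-suc zero    h = refl
∑-triangle-suc (suc n) h =
  trans (cong₂ _+_ (∑-last n (h 0)) (∑-triangle-suc n (h ∘ suc)))
        (interchange (∑ n (h 0)) (h 0 n) (∑-triangle n (h ∘ suc)) (∑-antidiagonal n (h ∘ suc)))

∑-triangle-swap : ∀ n h → ∑-triangle n h ≡ ∑-triangle n (λ a b → h b a)
∑-triangle-swap zero    h = refl
∑-triangle-swap (suc n) h = begin
  ∑-triangle (suc n) h                                ≡⟨ ∑-triangle-suc n h ⟩
  ∑-triangle n h + ∑-antidiagonal n h                 ≡⟨ cong₂ _+_ (∑-triangle-swap n h) antidiagonal-flip ⟩
  ∑-triangle n h′ + ∑-antidiagonal n h′               ≡⟨ ∑-triangle-suc n h′ ⟨
  ∑-triangle (suc n) h′                               ∎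
  where
  open ≡-Reasoning
  h′ : ℕ → ℕ → ℕ
  h′ a b = h b a
  antidiagonal-flip : ∑-antidiagonal n h ≡ ∑-antidiagonal n h′
  antidiagonal-flip =
    trans (∑-reverse n (λ a → h a (n ∸ suc a)))
          (∑-cong n (λ { a (s≤s a≤n) → cong (h (n ∸ suc a)) (m∸[m∸n]≡n a≤n) }))

-- Counting compositions

count : (n s : ℕ) → (Vec ℕ s → Bool) → ℕ
count n       (suc s) p = ∑ n (λ k → count (n ∸ suc k) s (p ∘ (suc k ∷_)))
count zero    zero    p = if p [] then 1 else 0
count (suc n) zero    p = 0

count-cong : ∀ n s {p q : Vec ℕ s → Bool} → p ≗ q → count n s p ≡ count n s q
count-cong n       (suc s) p≗q = ∑-cong n (λ k _ → count-cong (n ∸ suc k) s (p≗q ∘ (suc k ∷_)))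
count-cong zero    zero    p≗q = cong (if_then 1 else 0) (p≗q [])
count-cong (suc n) zero    p≗q = refl

count-false : ∀ n s → count n s (λ _ → false) ≡ 0
count-false n       (suc s) = ∑-zeros n (λ k → count-false (n ∸ suc k) s)
count-false zero    zero    = refl
count-false (suc n) zero    = refl

count-∧ : ∀ n s b (p : Vec ℕ s → Bool) → count n s (λ v → b ∧ p v) ≡ (if b then count n s p else 0)
count-∧ n s true  p = refl
count-∧ n s false p = count-false n s

count-∷ʳ : ∀ n s (p : Vec ℕ (suc s) → Bool) →
           count n (suc s) p ≡ ∑ n (λ k → count (n ∸ suc k) s (p ∘ (_∷ʳ suc k)))
count-∷ʳ n zero    p = ∑-cong n (λ k _ → count-cong (n ∸ suc k) 0 (λ { [] → refl }))
count-∷ʳ n (suc s) p = begin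
  ∑ n (λ a → count (n ∸ suc a) (suc s) (p ∘ (suc a ∷_)))
    ≡⟨ ∑-cong n (λ a _ → count-∷ʳ (n ∸ suc a) s (p ∘ (suc a ∷_))) ⟩
  ∑-triangle n (λ a b → count (n ∸ suc a ∸ suc b) s (λ w → p (suc a ∷ (w ∷ʳ suc b))))
    ≡⟨ ∑-triangle-swap n _ ⟩
  ∑-triangle n (λ b a → count (n ∸ suc a ∸ suc b) s (λ w → p (suc a ∷ (w ∷ʳ suc b))))
    ≡⟨ ∑-cong n (λ b _ → ∑-cong (n ∸ suc b) (λ a _ →
         cong (λ m → count m s (λ w → p (suc a ∷ (w ∷ʳ suc b)))) (∸-comm n (suc a) (suc b)))) ⟩
  ∑ n (λ b → count (n ∸ suc b) (suc s) (p ∘ (_∷ʳ suc b)))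
    ∎
  where
  open ≡-Reasoning
  ∸-comm : ∀ m n o → m ∸ n ∸ o ≡ m ∸ o ∸ n
  ∸-comm m n o = trans (∸-+-assoc m n o) (trans (cong (m ∸_) (+-comm n o)) (sym (∸-+-assoc m o n)))

module _ {a ℓ : Level} {A : Set a} {P : Pred A ℓ} (P? : Decidable P) where

  length-filter-map : ∀ {B : Set} (f : B → A) xs →
                      length (filter P? (map f xs)) ≡ length (filter (P? ∘ f) xs)
  length-filter-map f []       = refl
  length-filter-map f (x ∷ xs) with does (P? (f x))
  ... | true  = cong suc (length-filter-map f xs)
  ... | false = length-filter-map f xs

  length-filter-concatMap-applyUpTo : ∀ {B : Set} (f : B → List A) (g : ℕ → B) m →
    length (filter P? (concatMap f (applyUpTo g m))) ≡ ∑ m (λ k → length (filter P? (f (g k))))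
  length-filter-concatMap-applyUpTo f g zero    = refl
  length-filter-concatMap-applyUpTo f g (suc m) = begin
    length (filter P? (f (g 0) ++ rest))                  ≡⟨ cong length (filter-++ P? (f (g 0)) rest) ⟩
    length (filter P? (f (g 0)) ++ filter P? rest)        ≡⟨ length-++ (filter P? (f (g 0))) ⟩
    length (filter P? (f (g 0))) + length (filter P? rest)
      ≡⟨ cong (length (filter P? (f (g 0))) +_) (length-filter-concatMap-applyUpTo f (g ∘ suc) m) ⟩
    ∑ (suc m) (λ k → length (filter P? (f (g k))))        ∎
    where
    open ≡-Reasoning
    rest : List A
    rest = concatMap f (applyUpTo (g ∘ suc) m)

length-filter-compositions : ∀ {ℓ} n s {P : Pred (Vec ℕ s) ℓ} (P? : Decidable P) →
                             length (filter P? (compositions n s)) ≡ count n s (does ∘ P?)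
length-filter-compositions zero    zero    P? with does (P? [])
... | true  = refl
... | false = refl
length-filter-compositions (suc n) zero    P? = refl
length-filter-compositions zero    (suc s) P? = refl
length-filter-compositions (suc n) (suc s) P? =
  trans (length-filter-concatMap-applyUpTo P? prefixed id (suc n))
        (∑-cong (suc n) (λ k _ →
          trans (length-filter-map P? (suc k ∷_) (compositions (suc n ∸ suc k) s))
                (length-filter-compositions (suc n ∸ suc k) s (P? ∘ (suc k ∷_)))))
  where
  prefixed : ℕ → List (Vec ℕ (suc s))
  prefixed k = map (suc k ∷_) (compositions (suc n ∸ suc k) s)

antiPalindromicᵇ : ∀ {s} → Vec ℕ s → Bool
antiPalindromicᵇ = does ∘ antiPalindromic?

ac≡count : ∀ n s → ac n s ≡ count n s antiPalindromicᵇ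
ac≡count n s = length-filter-compositions n s antiPalindromic?

-- Removing the outer parts of an anti-palindromic composition

lookup-∷ʳ-fromℕ : ∀ {A : Set} {s} (w : Vec A s) y → lookup (w ∷ʳ y) (fromℕ s) ≡ y
lookup-∷ʳ-fromℕ []      y = refl
lookup-∷ʳ-fromℕ (x ∷ w) y = lookup-∷ʳ-fromℕ w y

lookup-∷ʳ-inject₁ : ∀ {A : Set} {s} (w : Vec A s) y j → lookup (w ∷ʳ y) (inject₁ j) ≡ lookup w j
lookup-∷ʳ-inject₁ (x ∷ w) y zero    = refl
lookup-∷ʳ-inject₁ (x ∷ w) y (suc j) = lookup-∷ʳ-inject₁ w y j

opposite-inject₁ : ∀ {s} (j : Fin s) → opposite {suc s} (inject₁ j) ≡ suc (opposite j)
opposite-inject₁ {suc s} zero    = refl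
opposite-inject₁ {suc s} (suc j) = cong inject₁ (opposite-inject₁ j)

inject₁-or-fromℕ : ∀ {s} (k : Fin (suc s)) → (∃ λ j → k ≡ inject₁ j) ⊎ k ≡ fromℕ s
inject₁-or-fromℕ {zero}  zero    = inj₂ refl
inject₁-or-fromℕ {suc s} zero    = inj₁ (zero , refl)
inject₁-or-fromℕ {suc s} (suc k) with inject₁-or-fromℕ k
... | inj₁ (j , refl) = inj₁ (suc j , refl)
... | inj₂ refl       = inj₂ refl

isMiddle-suc-inject₁ : ∀ {s} (j : Fin s) →
                       (2 * toℕ (suc (inject₁ j)) + 1 ≡ suc (suc s)) ⇔ (2 * toℕ j + 1 ≡ s)
isMiddle-suc-inject₁ j = mk⇔ (λ e → suc-injective (suc-injective (trans (sym shifted) e)))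
                             (λ e → trans shifted (cong (λ t → suc (suc t)) e))
  where
  shifted : 2 * toℕ (suc (inject₁ j)) + 1 ≡ suc (suc (2 * toℕ j + 1))
  shifted = trans (cong (_+ 1) (*-suc 2 (toℕ (inject₁ j))))
                  (cong (λ t → suc (suc (2 * t + 1))) (toℕ-inject₁ j))

module _ {s : ℕ} (x y : ℕ) (w : Vec ℕ s) where

  private
    v : Vec ℕ (suc (suc s))
    v = x ∷ (w ∷ʳ y)

    lookup-inner : ∀ j → lookup v (suc (inject₁ j)) ≡ lookup w j
    lookup-inner = lookup-∷ʳ-inject₁ w y

    lookup-opposite-inner : ∀ j → lookup v (opposite (suc (inject₁ j))) ≡ lookup w (opposite j)
    lookup-opposite-inner j =
      trans (cong (lookup v ∘ inject₁) (opposite-inject₁ j)) (lookup-∷ʳ-inject₁ w y (opposite j))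

    lookup-last : lookup v (suc (fromℕ s)) ≡ y
    lookup-last = lookup-∷ʳ-fromℕ w y

    opposite-last : opposite (suc (fromℕ s)) ≡ zero
    opposite-last = cong inject₁ (opposite-involutive zero)

  antiPalindromic-∷-∷ʳ : AntiPalindromic v ⇔ (x ≢ y × AntiPalindromic w)
  antiPalindromic-∷-∷ʳ = mk⇔ peel glue
    where
    peel : AntiPalindromic v → x ≢ y × AntiPalindromic w
    peel ap = (λ x≡y → ap zero (λ ()) (trans x≡y (sym lookup-last)))
            , (λ j notMiddle wⱼ≡ → ap (suc (inject₁ j)) (notMiddle ∘ Equivalence.to (isMiddle-suc-inject₁ j))
                                     (trans (lookup-inner j) (trans wⱼ≡ (sym (lookup-opposite-inner j)))))
    glue : x ≢ y × AntiPalindromic w → AntiPalindromic v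
    glue (x≢y , ap) zero    _         x≡ = x≢y (trans x≡ lookup-last)
    glue (x≢y , ap) (suc k) notMiddle vₖ≡ with inject₁-or-fromℕ k
    ... | inj₁ (j , refl) = ap j (notMiddle ∘ Equivalence.from (isMiddle-suc-inject₁ j))
                               (trans (sym (lookup-inner j)) (trans vₖ≡ (lookup-opposite-inner j)))
    ... | inj₂ refl       = x≢y (sym (trans (sym lookup-last) (trans vₖ≡ (cong (lookup v) opposite-last))))

antiPalindromicᵇ-∷-∷ʳ : ∀ {s} x y (w : Vec ℕ s) →
                        antiPalindromicᵇ (x ∷ (w ∷ʳ y)) ≡ not (does (x ≟ y)) ∧ antiPalindromicᵇ w
antiPalindromicᵇ-∷-∷ʳ x y w =
  does-⇔ (antiPalindromic-∷-∷ʳ x y w) (antiPalindromic? (x ∷ (w ∷ʳ y))) (¬? (x ≟ y) ×-dec antiPalindromic? w)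

-- a and b stand for the outer parts a + 1 and b + 1.
offDiagonal : (ℕ → ℕ) → ℕ → ℕ
offDiagonal g n =
  ∑ n (λ a → ∑ (n ∸ suc a) (λ b → if not (does (a ≟ b)) then g (n ∸ suc a ∸ suc b) else 0))

count-antiPalindromic-suc-suc : ∀ n s →
  count n (suc (suc s)) antiPalindromicᵇ ≡ offDiagonal (λ m → count m s antiPalindromicᵇ) n
count-antiPalindromic-suc-suc n s = ∑-cong n (λ a _ →
  trans (count-∷ʳ (n ∸ suc a) s (antiPalindromicᵇ ∘ (suc a ∷_)))
        (∑-cong (n ∸ suc a) (λ b _ →
          trans (count-cong (n ∸ suc a ∸ suc b) s (antiPalindromicᵇ-∷-∷ʳ (suc a) (suc b)))
                (count-∧ (n ∸ suc a ∸ suc b) s (not (does (a ≟ b))) antiPalindromicᵇ))))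

-- Summed downwards so that partialSum g (suc m) reduces to g m + partialSum g m.
partialSum : (ℕ → ℕ) → ℕ → ℕ
partialSum g m = ∑ m (λ b → g (m ∸ suc b))

termAt : ℕ → (ℕ → ℕ) → ℕ → ℕ
termAt zero    f a       = 0
termAt (suc m) f zero    = f 0
termAt (suc m) f (suc a) = termAt m (f ∘ suc) a

∑-without-termAt : ∀ m f a → ∑ m (λ b → if not (does (a ≟ b)) then f b else 0) + termAt m f a ≡ ∑ m f
∑-without-termAt zero    f a       = refl
∑-without-termAt (suc m) f zero    = +-comm (∑ m (f ∘ suc)) (f 0)
∑-without-termAt (suc m) f (suc a) =
  trans (+-assoc (f 0) _ (termAt m (f ∘ suc) a)) (cong (f 0 +_) (∑-without-termAt m (f ∘ suc) a))

-- The terms a = b of offDiagonal, so that diagonal g n = Σ_{2a+2 ≤ n} g (n - 2a - 2).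
diagonal : (ℕ → ℕ) → ℕ → ℕ
diagonal g n = ∑ n (λ a → termAt (n ∸ suc a) (λ b → g (n ∸ suc a ∸ suc b)) a)

offDiagonal+diagonal : ∀ g n → offDiagonal g n + diagonal g n ≡ partialSum (partialSum g) n
offDiagonal+diagonal g n =
  trans (∑-distrib-+ n _ _) (∑-cong n (λ a _ → ∑-without-termAt (n ∸ suc a) _ a))

diagonal-suc-suc : ∀ g n → diagonal g (suc (suc n)) ≡ g n + diagonal g n
diagonal-suc-suc g n = cong (g n +_) (begin
  ∑ (suc n) (λ a → φ (n ∸ a) (suc a))
    ≡⟨ ∑-cong (suc n) (λ a _ → trans (φ-suc (n ∸ a) a) (cong (λ m → φ m a) (pred[m∸n]≡m∸[1+n] n a))) ⟩
  ∑ (suc n) (λ a → φ (n ∸ suc a) a)   ≡⟨ ∑-last n _ ⟩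
  diagonal g n + φ (n ∸ suc n) n      ≡⟨ cong (λ m → diagonal g n + φ m n) (m≤n⇒m∸n≡0 (n≤1+n n)) ⟩
  diagonal g n + 0                    ≡⟨ +-identityʳ _ ⟩
  diagonal g n                        ∎)
  where
  open ≡-Reasoning
  φ : ℕ → ℕ → ℕ
  φ m = termAt m (λ b → g (m ∸ suc b))
  φ-suc : ∀ m a → φ m (suc a) ≡ φ (pred m) a
  φ-suc zero    a = refl
  φ-suc (suc m) a = refl

count-length-one : ∀ j → count (suc j) 1 (λ _ → true) ≡ 1
count-length-one zero    = refl
count-length-one (suc j) = count-length-one j

ac-length-one : ∀ j → ac (suc j) 1 ≡ 1
ac-length-one j =
  trans (ac≡count (suc j) 1)
        (trans (count-cong (suc j) 1 {antiPalindromicᵇ} {λ _ → true} (λ { (x ∷ []) → refl })) (count-length-one j))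

-- Formal power series

open import Data.Integer using (+_) renaming (_+_ to _+ℤ_; _-_ to _-ℤ_; _*_ to _*ℤ_)
open import Data.Integer.Properties using (pos-+; pos-*; +-inverseʳ; *-zeroʳ) renaming (+-identityʳ to +-identityʳᶻ)
open import Data.Integer.Tactic.RingSolver using (solve-∀)

infix  8 ↑_
infixl 6 _-ˢ_

↑_ : (ℕ → ℕ) → Series
(↑ f) n = + f n

_-ˢ_ : Series → Series → Series
(f -ˢ g) n = f n -ℤ g n

mulq : Series → Series
mulq f zero    = + 0
mulq f (suc n) = f n

mul2q³ : Series → Series
mul2q³ f n = + 2 *ℤ iter 3 mulq f n

mul[1-q]²[1+q] : Series → Series
mul[1-q]²[1+q] f = mul1-q (mul1-q (mul1+q f))

Congruent : (Series → Series) → Set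
Congruent F = ∀ {f g} → f ≗ g → F f ≗ F g

_CommutesWith_ : (Series → Series) → (Series → Series) → Set
F CommutesWith H = ∀ f → F (H f) ≗ H (F f)

mul1-q-cong : Congruent mul1-q
mul1-q-cong f≗g zero    = f≗g zero
mul1-q-cong f≗g (suc n) = cong₂ _-ℤ_ (f≗g (suc n)) (f≗g n)

mul1+q-cong : Congruent mul1+q
mul1+q-cong f≗g zero    = f≗g zero
mul1+q-cong f≗g (suc n) = cong₂ _+ℤ_ (f≗g (suc n)) (f≗g n)

mulq-cong : Congruent mulq
mulq-cong f≗g zero    = refl
mulq-cong f≗g (suc n) = f≗g n

iter-cong : ∀ {H} → Congruent H → ∀ k → Congruent (iter k H)
iter-cong H-cong zero    f≗g = f≗g
iter-cong H-cong (suc k) f≗g = H-cong (iter-cong H-cong k f≗g)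

mul2q³-cong : Congruent mul2q³
mul2q³-cong f≗g n = cong (+ 2 *ℤ_) (iter-cong mulq-cong 3 f≗g n)

mul[1-q]²[1+q]-cong : Congruent mul[1-q]²[1+q]
mul[1-q]²[1+q]-cong = mul1-q-cong ∘ mul1-q-cong ∘ mul1+q-cong

iter-commute : ∀ {F H} → Congruent H → F CommutesWith H → ∀ k → F CommutesWith (iter k H)
iter-commute H-cong F∘H zero    f n = refl
iter-commute H-cong F∘H (suc k) f n = trans (F∘H (iter k _ f) n) (H-cong (iter-commute H-cong F∘H k f) n)

mul1+q-commutesWith-mul1-q : mul1+q CommutesWith mul1-q
mul1+q-commutesWith-mul1-q f zero          = refl
mul1+q-commutesWith-mul1-q f (suc zero)    = identity (f 1) (f 0)
  where
  identity : ∀ a b → (a -ℤ b) +ℤ b ≡ (a +ℤ b) -ℤ b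
  identity = solve-∀
mul1+q-commutesWith-mul1-q f (suc (suc n)) = identity (f (suc (suc n))) (f (suc n)) (f n)
  where
  identity : ∀ a b c → (a -ℤ b) +ℤ (b -ℤ c) ≡ (a +ℤ b) -ℤ (b +ℤ c)
  identity = solve-∀

mul1-q-commutesWith-mulq : mul1-q CommutesWith mulq
mul1-q-commutesWith-mulq f zero          = refl
mul1-q-commutesWith-mulq f (suc zero)    = +-identityʳᶻ (f 0)
mul1-q-commutesWith-mulq f (suc (suc n)) = refl

mul[1-q]²[1+q]-commutesWith-mul1-q : mul[1-q]²[1+q] CommutesWith mul1-q
mul[1-q]²[1+q]-commutesWith-mul1-q f = mul1-q-cong (mul1-q-cong (mul1+q-commutesWith-mul1-q f))

mul[1-q]²[1+q]-commutesWith-mul1+q : mul[1-q]²[1+q] CommutesWith mul1+q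
mul[1-q]²[1+q]-commutesWith-mul1+q f n =
  sym (iter-commute mul1-q-cong mul1+q-commutesWith-mul1-q 2 (mul1+q f) n)

mul2q³-commutesWith-mul1-q : mul2q³ CommutesWith mul1-q
mul2q³-commutesWith-mul1-q f zero                      = refl
mul2q³-commutesWith-mul1-q f (suc zero)                = refl
mul2q³-commutesWith-mul1-q f (suc (suc zero))          = refl
mul2q³-commutesWith-mul1-q f (suc (suc (suc zero)))    = identity (f 0)
  where
  identity : ∀ a → + 2 *ℤ a ≡ + 2 *ℤ a -ℤ + 0
  identity = solve-∀
mul2q³-commutesWith-mul1-q f (suc (suc (suc (suc n)))) = identity (f (suc n)) (f n)
  where
  identity : ∀ a b → + 2 *ℤ (a -ℤ b) ≡ + 2 *ℤ a -ℤ + 2 *ℤ b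
  identity = solve-∀

mul2q³-commutesWith-mul1+q : mul2q³ CommutesWith mul1+q
mul2q³-commutesWith-mul1+q f zero                      = refl
mul2q³-commutesWith-mul1+q f (suc zero)                = refl
mul2q³-commutesWith-mul1+q f (suc (suc zero))          = refl
mul2q³-commutesWith-mul1+q f (suc (suc (suc zero)))    = sym (+-identityʳᶻ (+ 2 *ℤ f 0))
mul2q³-commutesWith-mul1+q f (suc (suc (suc (suc n)))) = identity (f (suc n)) (f n)
  where
  identity : ∀ a b → + 2 *ℤ (a +ℤ b) ≡ + 2 *ℤ a +ℤ + 2 *ℤ b
  identity = solve-∀

mul1-q-linear : ∀ f g → mul1-q (f -ˢ g) ≗ mul1-q f -ˢ mul1-q g
mul1-q-linear f g zero    = refl
mul1-q-linear f g (suc n) = identity (f (suc n)) (g (suc n)) (f n) (g n)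
  where
  identity : ∀ a b c d → (a -ℤ b) -ℤ (c -ℤ d) ≡ (a -ℤ c) -ℤ (b -ℤ d)
  identity = solve-∀

mul1+q-linear : ∀ f g → mul1+q (f -ˢ g) ≗ mul1+q f -ˢ mul1+q g
mul1+q-linear f g zero    = refl
mul1+q-linear f g (suc n) = identity (f (suc n)) (g (suc n)) (f n) (g n)
  where
  identity : ∀ a b c d → (a -ℤ b) +ℤ (c -ℤ d) ≡ (a +ℤ c) -ℤ (b +ℤ d)
  identity = solve-∀

mul[1-q]²[1+q]-linear : ∀ f g → mul[1-q]²[1+q] (f -ˢ g) ≗ mul[1-q]²[1+q] f -ˢ mul[1-q]²[1+q] g
mul[1-q]²[1+q]-linear f g n = begin
  mul1-q (mul1-q (mul1+q (f -ˢ g))) n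
    ≡⟨ mul1-q-cong (mul1-q-cong (mul1+q-linear f g)) n ⟩
  mul1-q (mul1-q (mul1+q f -ˢ mul1+q g)) n
    ≡⟨ mul1-q-cong (mul1-q-linear (mul1+q f) (mul1+q g)) n ⟩
  mul1-q (mul1-q (mul1+q f) -ˢ mul1-q (mul1+q g)) n
    ≡⟨ mul1-q-linear (mul1-q (mul1+q f)) (mul1-q (mul1+q g)) n ⟩
  mul[1-q]²[1+q] f n -ℤ mul[1-q]²[1+q] g n
    ∎
  where open ≡-Reasoning

mul1+q-minus-mul1-q : ∀ f n → mul1+q f n -ℤ mul1-q f n ≡ + 2 *ℤ mulq f n
mul1+q-minus-mul1-q f zero    = +-inverseʳ (f 0)
mul1+q-minus-mul1-q f (suc n) = identity (f (suc n)) (f n)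
  where
  identity : ∀ a b → (a +ℤ b) -ℤ (a -ℤ b) ≡ + 2 *ℤ b
  identity = solve-∀

+-minus-cancelʳ : ∀ a b → a +ℤ b -ℤ b ≡ a
+-minus-cancelʳ = solve-∀

↑-difference : ∀ {f g h} → (∀ n → f n + g n ≡ h n) → ↑ f ≗ ↑ h -ˢ ↑ g
↑-difference {f} {g} {h} f+g≡h n =
  sym (trans (cong (_-ℤ + g n) (trans (cong +_ (sym (f+g≡h n))) (pos-+ (f n) (g n))))
             (+-minus-cancelʳ (+ f n) (+ g n)))

mul1-q-partialSum : ∀ g → mul1-q (↑ partialSum g) ≗ mulq (↑ g)
mul1-q-partialSum g zero    = refl
mul1-q-partialSum g (suc n) =
  trans (cong (_-ℤ + partialSum g n) (pos-+ (g n) (partialSum g n)))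
        (+-minus-cancelʳ (+ g n) (+ partialSum g n))

mul1-q-mul1+q-diagonal : ∀ g → mul1-q (mul1+q (↑ diagonal g)) ≗ mulq (mulq (↑ g))
mul1-q-mul1+q-diagonal g zero          = refl
mul1-q-mul1+q-diagonal g (suc zero)    = refl
mul1-q-mul1+q-diagonal g (suc (suc n)) = begin
  (+ diagonal g (suc (suc n)) +ℤ + diagonal g (suc n)) -ℤ (+ diagonal g (suc n) +ℤ + diagonal g n)
    ≡⟨ cong (λ d → (d +ℤ + diagonal g (suc n)) -ℤ (+ diagonal g (suc n) +ℤ + diagonal g n))
            (trans (cong +_ (diagonal-suc-suc g n)) (pos-+ (g n) (diagonal g n))) ⟩
  ((+ g n +ℤ + diagonal g n) +ℤ + diagonal g (suc n)) -ℤ (+ diagonal g (suc n) +ℤ + diagonal g n)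
    ≡⟨ identity (+ g n) (+ diagonal g n) (+ diagonal g (suc n)) ⟩
  + g n
    ∎
  where
  open ≡-Reasoning
  identity : ∀ a b c → ((a +ℤ b) +ℤ c) -ℤ (c +ℤ b) ≡ a
  identity = solve-∀

-- (1-q)²(1+q) sends the sum over all pairs to (1+q)q²g and the diagonal to (1-q)q²g;
-- their difference is 2q³g.
mul[1-q]²[1+q]-offDiagonal : ∀ g → mul[1-q]²[1+q] (↑ offDiagonal g) ≗ mul2q³ (↑ g)
mul[1-q]²[1+q]-offDiagonal g n = begin
  mul[1-q]²[1+q] (↑ offDiagonal g) n
    ≡⟨ mul[1-q]²[1+q]-cong (↑-difference (offDiagonal+diagonal g)) n ⟩
  mul[1-q]²[1+q] (↑ T -ˢ ↑ diagonal g) n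
    ≡⟨ mul[1-q]²[1+q]-linear (↑ T) (↑ diagonal g) n ⟩
  mul1-q (mul1-q (mul1+q (↑ T))) n -ℤ mul1-q (mul1-q (mul1+q (↑ diagonal g))) n
    ≡⟨ cong₂ _-ℤ_ (trans (sym (iter-commute mul1-q-cong mul1+q-commutesWith-mul1-q 2 (↑ T) n))
                         (mul1+q-cong mul1-q²-T n))
                  (mul1-q-cong (mul1-q-mul1+q-diagonal g) n) ⟩
  mul1+q q²g n -ℤ mul1-q q²g n
    ≡⟨ mul1+q-minus-mul1-q q²g n ⟩
  mul2q³ (↑ g) n
    ∎
  where
  open ≡-Reasoning
  T : ℕ → ℕ
  T = partialSum (partialSum g)
  q²g : Series
  q²g = mulq (mulq (↑ g))
  mul1-q²-T : mul1-q (mul1-q (↑ T)) ≗ q²g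
  mul1-q²-T m = trans (mul1-q-cong (mul1-q-partialSum (partialSum g)) m)
                      (trans (mul1-q-commutesWith-mulq (↑ partialSum g) m)
                             (mulq-cong (mul1-q-partialSum g) m))

mulq-monomial : ∀ c m → mulq (monomial c m) ≗ monomial c (suc m)
mulq-monomial c m zero    = refl
mulq-monomial c m (suc n) with n ≟ m | suc n ≟ suc m
... | yes _   | yes _     = refl
... | no  _   | no  _     = refl
... | yes n≡m | no  n≢m   = contradiction (cong suc n≡m) n≢m
... | no  n≢m | yes n≡m   = contradiction (suc-injective n≡m) n≢m

iter-mulq-monomial : ∀ k c m → iter k mulq (monomial c m) ≗ monomial c (k + m)
iter-mulq-monomial zero    c m n = refl
iter-mulq-monomial (suc k) c m n =
  trans (mulq-cong (iter-mulq-monomial k c m) n) (mulq-monomial c (k + m) n)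

*-monomial : ∀ d c m n → d *ℤ monomial c m n ≡ monomial (d *ℤ c) m n
*-monomial d c m n with n ≟ m
... | yes _ = refl
... | no  _ = *-zeroʳ d

mul2q³-monomial : ∀ c m → mul2q³ (monomial c m) ≗ monomial (+ 2 *ℤ c) (3 + m)
mul2q³-monomial c m n =
  trans (cong (+ 2 *ℤ_) (iter-mulq-monomial 3 c m n)) (*-monomial (+ 2) c (3 + m) n)

iter-mul[1-q]²[1+q] : ∀ s k f → iter (2 + s) mul1-q (iter (suc k) mul1+q f) ≗
                     iter s mul1-q (iter k mul1+q (mul[1-q]²[1+q] f))
iter-mul[1-q]²[1+q] s k f n = begin
  mul1-q (mul1-q (iter s mul1-q (mul1+q h))) n
    ≡⟨ mul1-q-cong (mul1-q-cong (λ i → sym (iter-commute mul1-q-cong mul1+q-commutesWith-mul1-q s h i))) n ⟩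
  mul[1-q]²[1+q] (iter s mul1-q h) n
    ≡⟨ iter-commute mul1-q-cong mul[1-q]²[1+q]-commutesWith-mul1-q s h n ⟩
  iter s mul1-q (mul[1-q]²[1+q] h) n
    ≡⟨ iter-cong mul1-q-cong s (iter-commute mul1+q-cong mul[1-q]²[1+q]-commutesWith-mul1+q k f) n ⟩
  iter s mul1-q (iter k mul1+q (mul[1-q]²[1+q] f)) n
    ∎
  where
  open ≡-Reasoning
  h : Series
  h = iter k mul1+q f

mul2q³-iter : ∀ s k f → mul2q³ (iter s mul1-q (iter k mul1+q f)) ≗ iter s mul1-q (iter k mul1+q (mul2q³ f))
mul2q³-iter s k f n =
  trans (iter-commute mul1-q-cong mul2q³-commutesWith-mul1-q s (iter k mul1+q f) n)
        (iter-cong mul1-q-cong s (iter-commute mul1+q-cong mul2q³-commutesWith-mul1+q k f) n)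

G-suc-suc : ∀ s → mul[1-q]²[1+q] (G (suc (suc s))) ≗ mul2q³ (G s)
G-suc-suc s n = begin
  mul[1-q]²[1+q] (G (suc (suc s))) n
    ≡⟨ mul[1-q]²[1+q]-cong (λ m → cong +_ (trans (ac≡count m (suc (suc s))) (count-antiPalindromic-suc-suc m s))) n ⟩
  mul[1-q]²[1+q] (↑ offDiagonal (λ m → count m s antiPalindromicᵇ)) n
    ≡⟨ mul[1-q]²[1+q]-offDiagonal (λ m → count m s antiPalindromicᵇ) n ⟩
  mul2q³ (↑ (λ m → count m s antiPalindromicᵇ)) n
    ≡⟨ mul2q³-cong (λ m → cong +_ (sym (ac≡count m s))) n ⟩
  mul2q³ (G s) n
    ∎
  where open ≡-Reasoning

[2+s]/2≡1+s/2 : ∀ s → (2 + s) / 2 ≡ suc (s / 2)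
[2+s]/2≡1+s/2 s = +-distrib-/-∣ˡ {2} s {2} (divides 1 refl)

3[2+s]/2≡3+3s/2 : ∀ s → 3 * (2 + s) / 2 ≡ 3 + 3 * s / 2
3[2+s]/2≡3+3s/2 s = trans (cong (_/ 2) (*-distribˡ-+ 3 2 s)) (+-distrib-/-∣ˡ {6} (3 * s) {2} (divides 3 refl))

theorem3 : (s n : ℕ) →
    iter s mul1-q (iter (s / 2) mul1+q (G s)) n
      ≡ monomial (+ (2 ^ (s / 2))) ((3 * s) / 2) n
theorem3 zero          zero                = refl
theorem3 zero          (suc n)             = refl
theorem3 (suc zero)    zero                = refl
theorem3 (suc zero)    (suc zero)          = refl
theorem3 (suc zero)    (suc (suc n)) rewrite ac-length-one (suc n) | ac-length-one n = refl
theorem3 (suc (suc s)) n rewrite [2+s]/2≡1+s/2 s | 3[2+s]/2≡3+3s/2 s = begin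
  iter (2 + s) mul1-q (iter (suc (s / 2)) mul1+q (G (2 + s))) n
    ≡⟨ iter-mul[1-q]²[1+q] s (s / 2) (G (2 + s)) n ⟩
  iter s mul1-q (iter (s / 2) mul1+q (mul[1-q]²[1+q] (G (2 + s)))) n
    ≡⟨ iter-cong mul1-q-cong s (iter-cong mul1+q-cong (s / 2) (G-suc-suc s)) n ⟩
  iter s mul1-q (iter (s / 2) mul1+q (mul2q³ (G s))) n
    ≡⟨ mul2q³-iter s (s / 2) (G s) n ⟨
  mul2q³ (iter s mul1-q (iter (s / 2) mul1+q (G s))) n
    ≡⟨ mul2q³-cong (theorem3 s) n ⟩
  mul2q³ (monomial (+ (2 ^ (s / 2))) (3 * s / 2)) n
    ≡⟨ mul2q³-monomial (+ (2 ^ (s / 2))) (3 * s / 2) n ⟩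
  monomial (+ 2 *ℤ + (2 ^ (s / 2))) (3 + 3 * s / 2) n
    ≡⟨ cong (λ c → monomial c (3 + 3 * s / 2) n) (pos-* 2 (2 ^ (s / 2))) ⟨
  monomial (+ (2 ^ suc (s / 2))) (3 + 3 * s / 2) n
    ∎
  where open ≡-Reasoning
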